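{- Let $(G, \phi,(g_1, \dots, g_{N}))$ be a $[(k_1, \dots, k_n)]$-expansion group, where $N=k_1+\dots+k_n$. Then $((L_{\bullet}(G), [\,,]_{G}), L_{\bullet}(\phi))$ is a $[(k_1, \dots, k_n)]$-expansion Lie algebra.
   Context: Let $(k_1,\dots,k_n)\in\mathbb{Z}_{\ge1}^n$, $N=k_1+\dots+k_n$, $V_{[N]}=\mathbb{F}_2^N$ with basis $e_1,\dots,e_N$. The $s$-th block is $\{k_1+\dots+k_{s-1}+1,\dots,k_1+\dots+k_s\}$; $\pi:V_{[N]}\to\mathbb{F}_2^n$ sends $e_y$ to the $s$-th basis vector when $y$ is in the $s$-th block. Group commutator $[x,y]=xyx^{ -1}y^{ -1}$. An $N$-expansion group is $(G,\phi,(g_1,\dots,g_N))$ with $\phi:G\to V_{[N]}$ a homomorphism, $\phi(g_i)=e_i$, $\ker\phi$ elementary abelian $2$-group, $[G,G]=\ker\phi$, $g_i^2=1$. It is a $[(k_1,\dots,k_n)]$-expansion group if moreover $\phi^{ -1}(\ker\pi)$ is an elementary abelian $2$-group. $L_\bullet(G)=\bigoplus_{m\ge1}G^{(m)}/G^{(m+1)}$ ($G^{(1)}=G$, $G^{(i+1)}=[G,G^{(i)}]$) with the bracket induced by commutators, and $L_\bullet(\phi)$ the induced graded map to $V_{[N]}$ (abelian, concentrated in degree $1$). An $N$-expansion Lie algebra is $(L_\bullet,\psi)$: $L_\bullet=\bigoplus_{m\ge1}L_m$ a graded Lie algebra over $\mathbb{F}_2$, $\psi:L_\bullet\to V_{[N]}$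 a surjective graded Lie algebra homomorphism, $\ker\psi$ an abelian subalgebra, $[L_\bullet,L_\bullet]=\ker\psi$, and: for $i\ge4$ and $\sigma_1,\dots,\sigma_i\in L_1$ the nested commutator $[\sigma_1,[\sigma_2,[\dots,[\sigma_{i-1},\sigma_i]\dots]]]$ is independent of the order of the first $i-2$ entries and vanishes if two of the first $i-2$ entries are equal; and $[\tau_1,[\tau_1,\tau_2]]=0$ for $\tau_1,\tau_2\in L_1$ with $\psi(\tau_1)\in\{e_1,\dots,e_N\}$. (For such algebras $\psi|_{L_1}:L_1\to V_{[N]}$ is bijective.) It is a $[(k_1,\dots,k_n)]$-expansion Lie algebra if moreover (1) $\psi^{ -1}(\ker\pi)$ is an abelian subalgebra, and (2) for every $j\ge2$ and every $(i_1,\dots,i_j)\in[N]^j$ having two different positions whose entries lie in the same block, the commutator $[\psi|_{L_1}^{ -1}(e_{i_1}),[\psi|_{L_1}^{ -1}(e_{i_2}),[\dots,[\psi|_{L_1}^{ -1}(e_{i_{j-1}}),\psi|_{L_1}^{ -1}(e_{i_j})]\dots]]]$ vanishes. -}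

module Defs where

open import Level using (Level; _⊔_) renaming (suc to lsuc)
open import Data.Nat using (ℕ; zero; suc; _+_; _≤_)
open import Data.Bool using (Bool; true; false; _xor_)
open import Data.Fin as Fin using (Fin)
open import Data.Fin.Permutation using (Permutation′; _⟨$⟩ʳ_)
open import Data.Vec as Vec using (Vec; []; _∷_; sum; lookup; tabulate; zipWith; replicate; take; drop; foldr)
open import Data.Sum using (_⊎_; inj₁; inj₂)
open import Data.Product using (Σ; ∃; _×_; _,_)
open import Data.Unit.Polymorphic using (⊤)
open import Relation.Nullary using (¬_)
open import Relation.Nullary.Decidable using (⌊_⌋)
open import Relation.Binary.PropositionalEquality using (_≡_)
open import Algebra.Bundles using (Group)

V : ℕ → Set
V N = Vec Bool N

_⊕_ : ∀ {N} → V N → V N → V N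
_⊕_ = zipWith _xor_

𝟎 : ∀ {N} → V N
𝟎 = replicate _ false

-- standard basis vector e_i (0-based index i)
e : ∀ {N} → Fin N → V N
e i = tabulate (λ j → ⌊ i Fin.≟ j ⌋)

parity : ∀ {k} → Vec Bool k → Bool
parity = foldr _ _xor_ false

π : ∀ {n} (ks : Vec ℕ n) → V (sum ks) → V n
π []       v = []
π (k ∷ ks) v = parity (take k v) ∷ π ks (drop k v)

blockOf : ∀ {n} (ks : Vec ℕ n) → Fin (sum ks) → Fin n
blockOf []       ()
blockOf (k ∷ ks) y with Fin.splitAt k y
... | inj₁ _ = Fin.zero
... | inj₂ y′ = Fin.suc (blockOf ks y′)

module GroupDefs {c ℓ} (G : Group c ℓ) where
  open Group G

  comm : Carrier → Carrier → Carrier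
  comm x y = x ∙ y ∙ x ⁻¹ ∙ y ⁻¹

  data Gen (P : Carrier → Set (c ⊔ ℓ)) : Carrier → Set (c ⊔ ℓ) where
    gen  : ∀ {x} → P x → Gen P x
    unit : Gen P ε
    mul  : ∀ {x y} → Gen P x → Gen P y → Gen P (x ∙ y)
    inv  : ∀ {x} → Gen P x → Gen P (x ⁻¹)
    resp : ∀ {x y} → x ≈ y → Gen P x → Gen P y

  -- LCS d = G^{(d+1)}:  G^{(1)} = G,  G^{(i+1)} = [G , G^{(i)}]
  LCS : ℕ → Carrier → Set (c ⊔ ℓ)
  LCS zero    x = ⊤
  LCS (suc d) = Gen (λ z → Σ Carrier (λ x → Σ Carrier (λ y → LCS d y × z ≈ comm x y)))

record IsExpansionGroup {c ℓ} (G : Group c ℓ) (N : ℕ)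
         (φ : Group.Carrier G → V N) (g : Fin N → Group.Carrier G) : Set (c ⊔ ℓ) where
  open Group G
  open GroupDefs G
  field
    φ-cong   : ∀ {x y} → x ≈ y → φ x ≡ φ y
    φ-hom    : ∀ x y → φ (x ∙ y) ≡ φ x ⊕ φ y
    φ-gen    : ∀ i → φ (g i) ≡ e i
    ker-comm : ∀ {x y} → φ x ≡ 𝟎 → φ y ≡ 𝟎 → x ∙ y ≈ y ∙ x
    ker-sq   : ∀ {x} → φ x ≡ 𝟎 → x ∙ x ≈ ε
    -- [G , G] = ker φ   ([G , G] = G^{(2)} = LCS 1)
    der⊆ker  : ∀ {x} → LCS 1 x → φ x ≡ 𝟎
    ker⊆der  : ∀ {x} → φ x ≡ 𝟎 → LCS 1 x
    g-sq     : ∀ i → g i ∙ g i ≈ ε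

record IsKExpansionGroup {c ℓ} {n} (ks : Vec ℕ n) (G : Group c ℓ)
         (φ : Group.Carrier G → V (sum ks)) (g : Fin (sum ks) → Group.Carrier G) : Set (c ⊔ ℓ) where
  open Group G
  field
    isExpansionGroup : IsExpansionGroup G (sum ks) φ g
    preπ-comm : ∀ {x y} → π ks (φ x) ≡ 𝟎 → π ks (φ y) ≡ 𝟎 → x ∙ y ≈ y ∙ x
    preπ-sq   : ∀ {x} → π ks (φ x) ≡ 𝟎 → x ∙ x ≈ ε

-- Graded Lie algebras over F_2, encoded degreewise.
-- Index d : ℕ stands for degree d+1.  Hom d is the set of representatives of
-- L_{d+1} inside Carrier, and _≈⟨ d ⟩_ is equality in L_{d+1}.

record RawGradedLie a b r : Set (lsuc (a ⊔ b ⊔ r)) where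
  field
    Carrier : Set a
    Hom     : ℕ → Carrier → Set b
    _≈⟨_⟩_  : Carrier → ℕ → Carrier → Set r
    _+ᴸ_     : Carrier → Carrier → Carrier
    0#      : Carrier
    ⟦_,_⟧   : Carrier → Carrier → Carrier

  iter : ∀ n → (Fin n → Carrier) → Carrier → Carrier
  iter zero    σ z = z
  iter (suc n) σ z = ⟦ σ Fin.zero , iter n (λ t → σ (Fin.suc t)) z ⟧

  nested : ∀ m → (Fin (suc (suc m)) → Carrier) → Carrier
  nested zero    σ = ⟦ σ Fin.zero , σ (Fin.suc Fin.zero) ⟧
  nested (suc m) σ = ⟦ σ Fin.zero , nested m (λ t → σ (Fin.suc t)) ⟧

  data BrSpan (d : ℕ) : Carrier → Set (a ⊔ b ⊔ r) where
    bzero : BrSpan d 0#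
    bbr   : ∀ {i j x y} → Hom i x → Hom j y → suc (i + j) ≡ d → BrSpan d ⟦ x , y ⟧
    bplus : ∀ {x y} → BrSpan d x → BrSpan d y → BrSpan d (x +ᴸ y)
    bresp : ∀ {x y} → Hom d y → x ≈⟨ d ⟩ y → BrSpan d x → BrSpan d y

record IsGradedLieAlgebra {a b r} (L : RawGradedLie a b r) : Set (a ⊔ b ⊔ r) where
  open RawGradedLie L
  field
    ≈-refl   : ∀ {d x} → Hom d x → x ≈⟨ d ⟩ x
    ≈-sym    : ∀ {d x y} → Hom d x → Hom d y → x ≈⟨ d ⟩ y → y ≈⟨ d ⟩ x
    ≈-trans  : ∀ {d x y z} → Hom d x → Hom d y → Hom d z →
               x ≈⟨ d ⟩ y → y ≈⟨ d ⟩ z → x ≈⟨ d ⟩ z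
    0-mem    : ∀ {d} → Hom d 0#
    +-mem    : ∀ {d x y} → Hom d x → Hom d y → Hom d (x +ᴸ y)
    +-cong   : ∀ {d x x′ y y′} → Hom d x → Hom d x′ → Hom d y → Hom d y′ →
               x ≈⟨ d ⟩ x′ → y ≈⟨ d ⟩ y′ → (x +ᴸ y) ≈⟨ d ⟩ (x′ +ᴸ y′)
    +-assoc  : ∀ {d x y z} → Hom d x → Hom d y → Hom d z →
               ((x +ᴸ y) +ᴸ z) ≈⟨ d ⟩ (x +ᴸ (y +ᴸ z))
    +-comm   : ∀ {d x y} → Hom d x → Hom d y → (x +ᴸ y) ≈⟨ d ⟩ (y +ᴸ x)
    +-idˡ    : ∀ {d x} → Hom d x → (0# +ᴸ x) ≈⟨ d ⟩ x
    +-self   : ∀ {d x} → Hom d x → (x +ᴸ x) ≈⟨ d ⟩ 0#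
    br-mem   : ∀ {i j x y} → Hom i x → Hom j y → Hom (suc (i + j)) ⟦ x , y ⟧
    br-cong  : ∀ {i j x x′ y y′} → Hom i x → Hom i x′ → Hom j y → Hom j y′ →
               x ≈⟨ i ⟩ x′ → y ≈⟨ j ⟩ y′ → ⟦ x , y ⟧ ≈⟨ suc (i + j) ⟩ ⟦ x′ , y′ ⟧
    br-distˡ : ∀ {i j x y y′} → Hom i x → Hom j y → Hom j y′ →
               ⟦ x , y +ᴸ y′ ⟧ ≈⟨ suc (i + j) ⟩ (⟦ x , y ⟧ +ᴸ ⟦ x , y′ ⟧)
    br-distʳ : ∀ {i j x x′ y} → Hom i x → Hom i x′ → Hom j y →
               ⟦ x +ᴸ x′ , y ⟧ ≈⟨ suc (i + j) ⟩ (⟦ x , y ⟧ +ᴸ ⟦ x′ , y ⟧)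
    br-alt   : ∀ {i x} → Hom i x → ⟦ x , x ⟧ ≈⟨ suc (i + i) ⟩ 0#
    br-anti  : ∀ {i j x y} → Hom i x → Hom j y → ⟦ x , y ⟧ ≈⟨ suc (i + j) ⟩ ⟦ y , x ⟧
    jacobi   : ∀ {i j k x y z} → Hom i x → Hom j y → Hom k z →
               (⟦ x , ⟦ y , z ⟧ ⟧ +ᴸ (⟦ y , ⟦ z , x ⟧ ⟧ +ᴸ ⟦ z , ⟦ x , y ⟧ ⟧))
                 ≈⟨ suc (suc (i + j + k)) ⟩ 0#

-- degreewise description of ker ψ (ψ vanishes in degrees ≥ 2)
KerPart : ∀ {a b r} {N} (L : RawGradedLie a b r) (ψ : RawGradedLie.Carrier L → V N) →
          ℕ → RawGradedLie.Carrier L → Set b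
KerPart L ψ zero    x = RawGradedLie.Hom L zero x × ψ x ≡ 𝟎
KerPart L ψ (suc d) x = RawGradedLie.Hom L (suc d) x

PreπPart : ∀ {a b r} {n} (ks : Vec ℕ n) (L : RawGradedLie a b r)
           (ψ : RawGradedLie.Carrier L → V (sum ks)) → ℕ → RawGradedLie.Carrier L → Set b
PreπPart ks L ψ zero    x = RawGradedLie.Hom L zero x × π ks (ψ x) ≡ 𝟎
PreπPart ks L ψ (suc d) x = RawGradedLie.Hom L (suc d) x

-- N-expansion Lie algebra (L , ψ).  ψ is graded into V_[N] (concentrated in
-- degree 1), so it is given by its degree-1 part ψ : L_1 → V_[N]; it is zero
-- in degrees ≥ 2.
record IsExpansionLieAlgebra {a b r} (N : ℕ) (L : RawGradedLie a b r)
         (ψ : RawGradedLie.Carrier L → V N) : Set (a ⊔ b ⊔ r) where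
  open RawGradedLie L
  Ker = KerPart L ψ
  field
    isGradedLieAlgebra : IsGradedLieAlgebra L
    ψ-cong : ∀ {x y} → Hom 0 x → Hom 0 y → x ≈⟨ 0 ⟩ y → ψ x ≡ ψ y
    ψ-+    : ∀ {x y} → Hom 0 x → Hom 0 y → ψ (x +ᴸ y) ≡ ψ x ⊕ ψ y
    ψ-surj : ∀ v → Σ Carrier (λ x → Hom 0 x × ψ x ≡ v)
    ker-abelian : ∀ {i j x y} → Ker i x → Ker j y → ⟦ x , y ⟧ ≈⟨ suc (i + j) ⟩ 0#
    -- ker ψ ⊆ [L , L]   (the inclusion [L , L] ⊆ ker ψ holds by gradedness)
    ker⊆der₁ : ∀ {x} → Ker 0 x → x ≈⟨ 0 ⟩ 0#
    ker⊆der  : ∀ {d x} → Hom (suc d) x → BrSpan (suc d) x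
    -- nested commutators of i = r + 4 degree-one elements
    nest-perm : ∀ r (σ : Fin (suc (suc r)) → Carrier) {x y} →
                (∀ t → Hom 0 (σ t)) → Hom 0 x → Hom 0 y →
                (p : Permutation′ (suc (suc r))) →
                iter _ (λ t → σ (p ⟨$⟩ʳ t)) ⟦ x , y ⟧ ≈⟨ suc (suc (suc r)) ⟩ iter _ σ ⟦ x , y ⟧
    nest-rep  : ∀ r (σ : Fin (suc (suc r)) → Carrier) {x y} →
                (∀ t → Hom 0 (σ t)) → Hom 0 x → Hom 0 y →
                (p q : Fin (suc (suc r))) → ¬ p ≡ q → σ p ≈⟨ 0 ⟩ σ q →
                iter _ σ ⟦ x , y ⟧ ≈⟨ suc (suc (suc r)) ⟩ 0#
    basis-sq  : ∀ {τ₁ τ₂} → Hom 0 τ₁ → Hom 0 τ₂ → Σ (Fin N) (λ i → ψ τ₁ ≡ e i) →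
                ⟦ τ₁ , ⟦ τ₁ , τ₂ ⟧ ⟧ ≈⟨ 2 ⟩ 0#

record IsKExpansionLieAlgebra {a b r} {n} (ks : Vec ℕ n) (L : RawGradedLie a b r)
         (ψ : RawGradedLie.Carrier L → V (sum ks)) : Set (a ⊔ b ⊔ r) where
  open RawGradedLie L
  Preπ = PreπPart ks L ψ
  field
    isExpansionLieAlgebra : IsExpansionLieAlgebra (sum ks) L ψ
    preπ-abelian : ∀ {i j x y} → Preπ i x → Preπ j y → ⟦ x , y ⟧ ≈⟨ suc (i + j) ⟩ 0#
    block-rep : ∀ m (idx : Fin (suc (suc m)) → Fin (sum ks)) (σ : Fin (suc (suc m)) → Carrier) →
                (p q : Fin (suc (suc m))) → ¬ p ≡ q → blockOf ks (idx p) ≡ blockOf ks (idx q) →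
                (∀ t → Hom 0 (σ t)) → (∀ t → ψ (σ t) ≡ e (idx t)) →
                nested m σ ≈⟨ suc m ⟩ 0#

-- The graded Lie algebra L_•(G) = ⊕_m G^{(m)}/G^{(m+1)} (with L_•(φ) = φ
-- on degree one)

LieOf : ∀ {c ℓ} → Group c ℓ → RawGradedLie c (c ⊔ ℓ) (c ⊔ ℓ)
LieOf G = record
  { Carrier = Carrier
  ; Hom     = LCS
  ; _≈⟨_⟩_  = λ x d y → LCS (suc d) (x ∙ y ⁻¹)
  ; _+ᴸ_    = _∙_
  ; 0#      = ε
  ; ⟦_,_⟧   = comm
  }
  where
  open Group G
  open GroupDefs G

module Submission where

-- K = ker φ contains all commutators and is an elementary abelian
-- 2-group, so conjugation turns K into a module over G/K ≅ F_2^N.  Expanding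
-- [x,[y,z]] inside K gives, writing ʰu = h u h⁻¹, the identity
--     [x,[y,z]] = ([x,y] · ᶻ[x,y]) · ([x,z] · ʸ[x,z])            (ker-expansion)
-- from which the Jacobi identity, the symmetry of iterated commutators in their
-- outer entries, and [b,[b,u]] = 1 for u ∈ K all follow as exact group
-- identities.  The block conditions come from the fact that two generators of
-- the same block differ by an element of φ⁻¹(ker π), which is again an
-- elementary abelian 2-group.

open import Level using (_⊔_)
open import Data.Nat using (ℕ; zero; suc; _+_; _≤_; _≤′_; ≤′-refl; ≤′-step; s≤s; _≡ᵇ_)
open import Data.Nat.Properties using (m≤n+m; n≤1+n; ≤-trans; ≤⇒≤′; +-suc; +-identityʳ; ≡ᵇ⇒≡)
open import Data.Bool using (Bool; true; false; _xor_; _∧_; T; not)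
open import Data.Bool.Properties using (xor-same; xor-assoc; xor-comm; xor-identityˡ; xor-identityʳ; xor-∧-commutativeRing)
open import Data.Empty using (⊥-elim)
open import Data.Fin as Fin using (Fin; _↑ˡ_; _↑ʳ_; punchIn; punchOut)
open import Data.Fin.Permutation using (Permutation′; _⟨$⟩ʳ_; remove; punchIn-permute)
open import Data.Fin.Properties using (punchIn-punchOut; splitAt⁻¹-↑ˡ; splitAt⁻¹-↑ʳ)
open import Data.List using (List; []; _∷_; _++_)
open import Data.List.Relation.Unary.All using (All; []; _∷_)
open import Data.Product using (Σ; _×_; _,_)
open import Data.Sum using (inj₁; inj₂)
open import Data.Unit.Polymorphic using (⊤; tt)
open import Data.Vec as Vec using (Vec; []; _∷_; sum; lookup; tabulate; take; drop)
open import Data.Vec.Properties using (tabulate-cong; zipWith-comm; zipWith-assoc; zipWith-identityˡ; zipWith-identityʳ; take-zipWith; drop-zipWith)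
open import Relation.Binary.PropositionalEquality as P using (_≡_)
open import Relation.Nullary using (yes; no; ¬_)
open import Relation.Nullary.Decidable using (⌊_⌋)
open import Algebra.Bundles using (Group; CommutativeRing)
open import Algebra.Properties.CommutativeSemigroup
  (CommutativeRing.+-commutativeSemigroup xor-∧-commutativeRing) using () renaming (interchange to xor-interchange)
open import Defs

-- (1) Identities valid in every group, decided by free reduction: a word
-- expression is flattened to a list of letters x_i^{±1} and adjacent inverse
-- letters are cancelled; equal normal forms give equal values.

module GroupWords {c ℓ} (G : Group c ℓ) where
  open Group G
  open import Algebra.Properties.Group G using (⁻¹-anti-homo-∙; ⁻¹-involutive; ε⁻¹≈ε)
  open import Relation.Binary.Reasoning.Setoid setoid

  infixl 7 _∙ₑ_
  infix 8 _⁻¹ₑ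
  data Expr : Set where
    var   : ℕ → Expr
    _∙ₑ_  : Expr → Expr → Expr
    _⁻¹ₑ  : Expr → Expr
    εₑ    : Expr

  x₀ x₁ x₂ x₃ : Expr
  x₀ = var 0
  x₁ = var 1
  x₂ = var 2
  x₃ = var 3

  ⟪_,_⟫ : Expr → Expr → Expr
  ⟪ a , b ⟫ = a ∙ₑ b ∙ₑ a ⁻¹ₑ ∙ₑ b ⁻¹ₑ

  conjₑ : Expr → Expr → Expr
  conjₑ a w = a ∙ₑ w ∙ₑ a ⁻¹ₑ

  Letter : Set
  Letter = Bool × ℕ

  invLetter : Letter → Letter
  invLetter (b , i) = (not b , i)

  invWord : List Letter → List Letter
  invWord [] = []
  invWord (l ∷ w) = invWord w ++ (invLetter l ∷ [])

  word : Expr → List Letter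
  word (var i) = (true , i) ∷ []
  word (a ∙ₑ b) = word a ++ word b
  word (a ⁻¹ₑ) = invWord (word a)
  word εₑ = []

  cancels : Letter → Letter → Bool
  cancels (b , i) (b′ , i′) = (b xor b′) ∧ (i ≡ᵇ i′)

  push : Letter → List Letter → List Letter
  push l [] = l ∷ []
  push l (l′ ∷ w) with cancels l l′
  ... | true = w
  ... | false = l ∷ l′ ∷ w

  reduce : List Letter → List Letter
  reduce [] = []
  reduce (l ∷ w) = push l (reduce w)

  normal : Expr → List Letter
  normal a = reduce (word a)

  get : List Carrier → ℕ → Carrier
  get [] _ = ε
  get (x ∷ xs) zero = x
  get (x ∷ xs) (suc n) = get xs n

  module _ (ρ : List Carrier) where
    eval : Expr → Carrier
    eval (var i) = get ρ i
    eval (a ∙ₑ b) = eval a ∙ eval b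
    eval (a ⁻¹ₑ) = eval a ⁻¹
    eval εₑ = ε

    evalLetter : Letter → Carrier
    evalLetter (true , i) = get ρ i
    evalLetter (false , i) = get ρ i ⁻¹

    evalWord : List Letter → Carrier
    evalWord [] = ε
    evalWord (l ∷ w) = evalLetter l ∙ evalWord w

    evalWord-++ : ∀ u w → evalWord (u ++ w) ≈ evalWord u ∙ evalWord w
    evalWord-++ [] w = sym (identityˡ _)
    evalWord-++ (l ∷ u) w = trans (∙-congˡ (evalWord-++ u w)) (sym (assoc _ _ _))

    evalLetter-inv : ∀ l → evalLetter (invLetter l) ≈ evalLetter l ⁻¹
    evalLetter-inv (true , i) = refl
    evalLetter-inv (false , i) = sym (⁻¹-involutive _)

    evalWord-inv : ∀ w → evalWord (invWord w) ≈ evalWord w ⁻¹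
    evalWord-inv [] = sym ε⁻¹≈ε
    evalWord-inv (l ∷ w) = begin
      evalWord (invWord w ++ (invLetter l ∷ []))        ≈⟨ evalWord-++ (invWord w) _ ⟩
      evalWord (invWord w) ∙ (evalLetter (invLetter l) ∙ ε)
        ≈⟨ ∙-cong (evalWord-inv w) (trans (identityʳ _) (evalLetter-inv l)) ⟩
      evalWord w ⁻¹ ∙ evalLetter l ⁻¹                    ≈⟨ sym (⁻¹-anti-homo-∙ _ _) ⟩
      (evalLetter l ∙ evalWord w) ⁻¹                     ∎

    evalWord-word : ∀ a → evalWord (word a) ≈ eval a
    evalWord-word (var i) = identityʳ _
    evalWord-word (a ∙ₑ b) = trans (evalWord-++ (word a) (word b)) (∙-cong (evalWord-word a) (evalWord-word b))
    evalWord-word (a ⁻¹ₑ) = trans (evalWord-inv (word a)) (⁻¹-cong (evalWord-word a))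
    evalWord-word εₑ = refl

    cancels-sound : ∀ l l′ → T (cancels l l′) → evalLetter l ∙ evalLetter l′ ≈ ε
    cancels-sound (true , i) (false , i′) t with ≡ᵇ⇒≡ i i′ t
    ... | P.refl = inverseʳ _
    cancels-sound (false , i) (true , i′) t with ≡ᵇ⇒≡ i i′ t
    ... | P.refl = inverseˡ _

    push-sound : ∀ l w → evalWord (push l w) ≈ evalLetter l ∙ evalWord w
    push-sound l [] = refl
    push-sound l (l′ ∷ w) with cancels l l′ in eq
    ... | false = refl
    ... | true = begin
      evalWord w                                     ≈⟨ sym (identityˡ _) ⟩
      ε ∙ evalWord w                                 ≈⟨ ∙-congʳ (sym (cancels-sound l l′ (P.subst T (P.sym eq) _))) ⟩
      (evalLetter l ∙ evalLetter l′) ∙ evalWord w    ≈⟨ assoc _ _ _ ⟩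
      evalLetter l ∙ (evalLetter l′ ∙ evalWord w)    ∎

    reduce-sound : ∀ w → evalWord (reduce w) ≈ evalWord w
    reduce-sound [] = refl
    reduce-sound (l ∷ w) = trans (push-sound l (reduce w)) (∙-congˡ (reduce-sound w))

    solve : ∀ a b → normal a ≡ normal b → eval a ≈ eval b
    solve a b eq = begin
      eval a               ≈⟨ sym (evalWord-word a) ⟩
      evalWord (word a)    ≈⟨ sym (reduce-sound (word a)) ⟩
      evalWord (normal a)  ≡⟨ P.cong evalWord eq ⟩
      evalWord (normal b)  ≈⟨ reduce-sound (word b) ⟩
      evalWord (word b)    ≈⟨ evalWord-word b ⟩
      eval b               ∎

-- (2) Linear algebra over F_2

⊕-comm : ∀ {N} (u v : V N) → u ⊕ v ≡ v ⊕ u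
⊕-comm = zipWith-comm xor-comm

⊕-assoc : ∀ {N} (u v w : V N) → (u ⊕ v) ⊕ w ≡ u ⊕ (v ⊕ w)
⊕-assoc = zipWith-assoc xor-assoc

⊕-identityˡ : ∀ {N} (u : V N) → 𝟎 ⊕ u ≡ u
⊕-identityˡ = zipWith-identityˡ xor-identityˡ

⊕-identityʳ : ∀ {N} (u : V N) → u ⊕ 𝟎 ≡ u
⊕-identityʳ = zipWith-identityʳ xor-identityʳ

⊕-self : ∀ {N} (u : V N) → u ⊕ u ≡ 𝟎
⊕-self [] = P.refl
⊕-self (a ∷ u) = P.cong₂ _∷_ (xor-same a) (⊕-self u)

⊕-cancel : ∀ {N} (u v : V N) → u ⊕ v ≡ 𝟎 → u ≡ v
⊕-cancel u v eq = begin
  u             ≡⟨ P.sym (⊕-identityʳ u) ⟩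
  u ⊕ 𝟎         ≡⟨ P.cong (u ⊕_) (P.sym (⊕-self v)) ⟩
  u ⊕ (v ⊕ v)   ≡⟨ P.sym (⊕-assoc u v v) ⟩
  (u ⊕ v) ⊕ v   ≡⟨ P.cong (_⊕ v) eq ⟩
  𝟎 ⊕ v         ≡⟨ ⊕-identityˡ v ⟩
  v             ∎
  where open P.≡-Reasoning

-- (u + v) + u + v = 0: the image of a commutator under a map to F_2^N
⊕-commutator : ∀ {N} (u v : V N) → ((u ⊕ v) ⊕ u) ⊕ v ≡ 𝟎
⊕-commutator u v = begin
  ((u ⊕ v) ⊕ u) ⊕ v   ≡⟨ P.cong (_⊕ v) (P.cong (_⊕ u) (⊕-comm u v)) ⟩
  ((v ⊕ u) ⊕ u) ⊕ v   ≡⟨ P.cong (_⊕ v) (⊕-assoc v u u) ⟩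
  (v ⊕ (u ⊕ u)) ⊕ v   ≡⟨ P.cong (λ t → (v ⊕ t) ⊕ v) (⊕-self u) ⟩
  (v ⊕ 𝟎) ⊕ v         ≡⟨ P.cong (_⊕ v) (⊕-identityʳ v) ⟩
  v ⊕ v               ≡⟨ ⊕-self v ⟩
  𝟎                   ∎
  where open P.≡-Reasoning

parity-⊕ : ∀ {k} (u v : V k) → parity (u ⊕ v) ≡ parity u xor parity v
parity-⊕ [] [] = P.refl
parity-⊕ (a ∷ u) (b ∷ v) =
  P.trans (P.cong ((a xor b) xor_) (parity-⊕ u v)) (xor-interchange a b (parity u) (parity v))

parity-𝟎 : ∀ k → parity {k} 𝟎 ≡ false
parity-𝟎 zero = P.refl
parity-𝟎 (suc k) = parity-𝟎 k

π-⊕ : ∀ {n} (ks : Vec ℕ n) (u v : V (sum ks)) → π ks (u ⊕ v) ≡ π ks u ⊕ π ks v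
π-⊕ [] [] [] = P.refl
π-⊕ (k ∷ ks) u v = P.cong₂ _∷_
  (P.trans (P.cong parity (take-zipWith {m = k} _xor_ u v)) (parity-⊕ (take k u) (take k v)))
  (P.trans (P.cong (π ks) (drop-zipWith {m = k} _xor_ u v)) (π-⊕ ks (drop k u) (drop k v)))

π-𝟎 : ∀ {n} (ks : Vec ℕ n) → π ks 𝟎 ≡ 𝟎
π-𝟎 ks = P.trans (P.cong (π ks) (P.sym (⊕-self 𝟎))) (P.trans (π-⊕ ks 𝟎 𝟎) (⊕-self (π ks 𝟎)))

take-𝟎 : ∀ k {m} → take k {m} 𝟎 ≡ 𝟎
take-𝟎 zero = P.refl
take-𝟎 (suc k) = P.cong (false ∷_) (take-𝟎 k)

drop-𝟎 : ∀ k {m} → drop k {m} 𝟎 ≡ 𝟎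
drop-𝟎 zero = P.refl
drop-𝟎 (suc k) = drop-𝟎 k

e-zero : ∀ {m} → e {suc m} Fin.zero ≡ true ∷ 𝟎
e-zero {m} = P.cong (true ∷_) (all-false m)
  where
  all-false : ∀ m → tabulate {n = m} (λ _ → false) ≡ 𝟎
  all-false zero = P.refl
  all-false (suc m) = P.cong (false ∷_) (all-false m)

e-suc : ∀ {m} (i : Fin m) → e (Fin.suc i) ≡ false ∷ e i
e-suc i = P.cong (false ∷_) (tabulate-cong (suc-≟ i))
  where
  suc-≟ : ∀ {m} (i j : Fin m) → ⌊ Fin.suc i Fin.≟ Fin.suc j ⌋ ≡ ⌊ i Fin.≟ j ⌋
  suc-≟ i j with i Fin.≟ j
  ... | yes P.refl = P.refl
  ... | no _ = P.refl

parity-e : ∀ {k} (i : Fin k) → parity (e i) ≡ true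
parity-e {suc k} Fin.zero = P.trans (P.cong parity (e-zero {k})) (P.cong not (parity-𝟎 k))
parity-e (Fin.suc i) = P.trans (P.cong parity (e-suc i)) (parity-e i)

take-e↑ˡ : ∀ k {m} (i : Fin k) → take k (e (i ↑ˡ m)) ≡ e i
take-e↑ˡ (suc k) Fin.zero =
  P.trans (P.cong (take (suc k)) e-zero) (P.trans (P.cong (true ∷_) (take-𝟎 k)) (P.sym e-zero))
take-e↑ˡ (suc k) (Fin.suc i) =
  P.trans (P.cong (take (suc k)) (e-suc _)) (P.trans (P.cong (false ∷_) (take-e↑ˡ k i)) (P.sym (e-suc i)))

drop-e↑ˡ : ∀ k {m} (i : Fin k) → drop k {m} (e (i ↑ˡ m)) ≡ 𝟎
drop-e↑ˡ (suc k) Fin.zero = P.trans (P.cong (drop (suc k)) e-zero) (drop-𝟎 k)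
drop-e↑ˡ (suc k) (Fin.suc i) = P.trans (P.cong (drop (suc k)) (e-suc _)) (drop-e↑ˡ k i)

take-e↑ʳ : ∀ k {m} (i : Fin m) → take k (e (k ↑ʳ i)) ≡ 𝟎
take-e↑ʳ zero i = P.refl
take-e↑ʳ (suc k) i = P.trans (P.cong (take (suc k)) (e-suc _)) (P.cong (false ∷_) (take-e↑ʳ k i))

drop-e↑ʳ : ∀ k {m} (i : Fin m) → drop k (e (k ↑ʳ i)) ≡ e i
drop-e↑ʳ zero i = P.refl
drop-e↑ʳ (suc k) i = P.trans (P.cong (drop (suc k)) (e-suc _)) (drop-e↑ʳ k i)

π-e : ∀ {n} (ks : Vec ℕ n) (y : Fin (sum ks)) → π ks (e y) ≡ e (blockOf ks y)
π-e (k ∷ ks) y with Fin.splitAt k y in eq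
... | inj₁ y′ rewrite P.sym (splitAt⁻¹-↑ˡ eq) =
  P.trans (P.cong₂ _∷_ (P.trans (P.cong parity (take-e↑ˡ k y′)) (parity-e y′))
                        (P.trans (P.cong (π ks) (drop-e↑ˡ k y′)) (π-𝟎 ks)))
          (P.sym e-zero)
... | inj₂ y′ rewrite P.sym (splitAt⁻¹-↑ʳ eq) =
  P.trans (P.cong₂ _∷_ (P.trans (P.cong parity (take-e↑ʳ k y′)) (parity-𝟎 k))
                        (P.trans (P.cong (π ks) (drop-e↑ʳ k y′)) (π-e ks y′)))
          (P.sym (e-suc _))

SameBlock : ∀ {n} (ks : Vec ℕ n) → Fin (sum ks) → Fin (sum ks) → Set
SameBlock ks a b = blockOf ks a ≡ blockOf ks b

π-same-block : ∀ {n} (ks : Vec ℕ n) {a b} → SameBlock ks a b → π ks (e a ⊕ e b) ≡ 𝟎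
π-same-block ks {a} {b} same = begin
  π ks (e a ⊕ e b)                        ≡⟨ π-⊕ ks (e a) (e b) ⟩
  π ks (e a) ⊕ π ks (e b)                 ≡⟨ P.cong₂ _⊕_ (π-e ks a) (π-e ks b) ⟩
  e (blockOf ks a) ⊕ e (blockOf ks b)     ≡⟨ P.cong (λ t → e (blockOf ks a) ⊕ e t) (P.sym same) ⟩
  e (blockOf ks a) ⊕ e (blockOf ks a)     ≡⟨ ⊕-self _ ⟩
  𝟎                                       ∎
  where open P.≡-Reasoning

basis-induction : ∀ {a} m (S : V m → Set a) → (∀ {u v} → S u → S v → S (u ⊕ v)) → S 𝟎 →
                  (∀ i → S (e i)) → ∀ u → S u
basis-induction zero S _ s𝟎 _ [] = s𝟎
basis-induction (suc m) S s⊕ s𝟎 se (b ∷ u) = with-head b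
  where
  tail-part : S (false ∷ u)
  tail-part = basis-induction m (λ w → S (false ∷ w)) s⊕ s𝟎 (λ i → P.subst S (e-suc i) (se (Fin.suc i))) u
  with-head : ∀ b → S (b ∷ u)
  with-head false = tail-part
  with-head true = P.subst S (P.trans (P.cong (_⊕ (false ∷ u)) e-zero) (P.cong (true ∷_) (⊕-identityˡ u)))
                             (s⊕ (se Fin.zero) tail-part)

-- (3) Commutators and the lower central series in an arbitrary group

module LowerCentralSeries {c ℓ} (G : Group c ℓ) where
  open Group G
  open GroupDefs G
  open GroupWords G public
  open import Relation.Binary.Reasoning.Setoid setoid

  conj : Carrier → Carrier → Carrier
  conj x w = x ∙ w ∙ x ⁻¹

  comm-cong : ∀ {x x′ y y′} → x ≈ x′ → y ≈ y′ → comm x y ≈ comm x′ y′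
  comm-cong p q = ∙-cong (∙-cong (∙-cong p q) (⁻¹-cong p)) (⁻¹-cong q)

  conj-cong : ∀ {x x′ y y′} → x ≈ x′ → y ≈ y′ → conj x y ≈ conj x′ y′
  conj-cong p q = ∙-cong (∙-cong p q) (⁻¹-cong p)

  comm-inv : ∀ x y → comm y x ⁻¹ ≈ comm x y
  comm-inv x y = solve (x ∷ y ∷ []) (⟪ x₁ , x₀ ⟫ ⁻¹ₑ) ⟪ x₀ , x₁ ⟫ P.refl

  comm-via-conj : ∀ x w → comm x w ≈ conj x w ∙ w ⁻¹
  comm-via-conj x w = solve (x ∷ w ∷ []) ⟪ x₀ , x₁ ⟫ (conjₑ x₀ x₁ ∙ₑ x₁ ⁻¹ₑ) P.refl

  comm-commuting : ∀ {x y} → x ∙ y ≈ y ∙ x → comm x y ≈ ε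
  comm-commuting {x} {y} xy≈yx = begin
    x ∙ y ∙ x ⁻¹ ∙ y ⁻¹  ≈⟨ ∙-congʳ (∙-congʳ xy≈yx) ⟩
    y ∙ x ∙ x ⁻¹ ∙ y ⁻¹  ≈⟨ solve (x ∷ y ∷ []) (x₁ ∙ₑ x₀ ∙ₑ x₀ ⁻¹ₑ ∙ₑ x₁ ⁻¹ₑ) εₑ P.refl ⟩
    ε                    ∎

  comm-ε : ∀ x → comm x ε ≈ ε
  comm-ε x = solve (x ∷ []) ⟪ x₀ , εₑ ⟫ εₑ P.refl

  conj-absorb : ∀ {h z w} → h ∙ conj z w ≈ conj z w ∙ h → conj (h ∙ z) w ≈ conj z w
  conj-absorb {h} {z} {w} eq = begin
    conj (h ∙ z) w        ≈⟨ solve (h ∷ z ∷ w ∷ []) (conjₑ (x₀ ∙ₑ x₁) x₂) (x₀ ∙ₑ conjₑ x₁ x₂ ∙ₑ x₀ ⁻¹ₑ) P.refl ⟩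
    h ∙ conj z w ∙ h ⁻¹   ≈⟨ ∙-congʳ eq ⟩
    conj z w ∙ h ∙ h ⁻¹   ≈⟨ solve (h ∷ z ∷ w ∷ []) (conjₑ x₁ x₂ ∙ₑ x₀ ∙ₑ x₀ ⁻¹ₑ) (conjₑ x₁ x₂) P.refl ⟩
    conj z w              ∎

  comm-absorb : ∀ {a b w} → (a ∙ b ⁻¹) ∙ conj b w ≈ conj b w ∙ (a ∙ b ⁻¹) → comm a w ≈ comm b w
  comm-absorb {a} {b} {w} eq = begin
    comm a w                        ≈⟨ comm-via-conj a w ⟩
    conj a w ∙ w ⁻¹                 ≈⟨ ∙-congʳ (conj-cong (solve (a ∷ b ∷ []) x₀ ((x₀ ∙ₑ x₁ ⁻¹ₑ) ∙ₑ x₁) P.refl) refl) ⟩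
    conj ((a ∙ b ⁻¹) ∙ b) w ∙ w ⁻¹  ≈⟨ ∙-congʳ (conj-absorb eq) ⟩
    conj b w ∙ w ⁻¹                 ≈⟨ sym (comm-via-conj b w) ⟩
    comm b w                        ∎

  Gen-map : ∀ {Q R : Carrier → Set (c ⊔ ℓ)} → (∀ {z} → Q z → R z) → ∀ {x} → Gen Q x → Gen R x
  Gen-map f (gen q) = gen (f q)
  Gen-map f unit = unit
  Gen-map f (mul a b) = mul (Gen-map f a) (Gen-map f b)
  Gen-map f (inv a) = inv (Gen-map f a)
  Gen-map f (resp e a) = resp e (Gen-map f a)

  LCS-suc : ∀ d {x} → LCS (suc d) x → LCS d x
  LCS-suc zero _ = tt
  LCS-suc (suc d) = Gen-map (λ { (x , y , ly , eq) → x , y , LCS-suc d ly , eq })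

  LCS-antitone : ∀ {m k x} → m ≤ k → LCS k x → LCS m x
  LCS-antitone le = go (≤⇒≤′ le)
    where
    go : ∀ {m k x} → m ≤′ k → LCS k x → LCS m x
    go ≤′-refl l = l
    go (≤′-step le) l = go le (LCS-suc _ l)

  LCS-ε : ∀ d → LCS d ε
  LCS-ε zero = tt
  LCS-ε (suc d) = unit

  LCS-∙ : ∀ d {x y} → LCS d x → LCS d y → LCS d (x ∙ y)
  LCS-∙ zero _ _ = tt
  LCS-∙ (suc d) a b = mul a b

  LCS-resp : ∀ d {x y} → x ≈ y → LCS d x → LCS d y
  LCS-resp zero _ _ = tt
  LCS-resp (suc d) eq a = resp eq a

  LCS-≈ε : ∀ d {x} → x ≈ ε → LCS d x
  LCS-≈ε d eq = LCS-resp d (sym eq) (LCS-ε d)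

  LCS-commʳ : ∀ d {x y} → LCS d y → LCS (suc d) (comm x y)
  LCS-commʳ d {x} {y} ly = gen (x , y , ly , refl)

  LCS-commˡ : ∀ d {x y} → LCS d x → LCS (suc d) (comm x y)
  LCS-commˡ d {x} {y} lx = resp (comm-inv x y) (inv (LCS-commʳ d lx))

  LCS-conj : ∀ d x {w} → LCS d w → LCS d (conj x w)
  LCS-conj zero x _ = tt
  LCS-conj (suc d) x {w} lw =
    resp (solve (x ∷ w ∷ []) (⟪ x₀ , x₁ ⟫ ∙ₑ x₁) (conjₑ x₀ x₁) P.refl)
         (mul (LCS-suc (suc d) (LCS-commʳ (suc d) lw)) lw)

  -- congruence modulo G^{(d+2)}: the equality of L_{d+1} = G^{(d+1)}/G^{(d+2)}
  Congruent : ℕ → Carrier → Carrier → Set (c ⊔ ℓ)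
  Congruent d x y = LCS (suc d) (x ∙ y ⁻¹)

  ≈⇒Congruent : ∀ d {x y} → x ≈ y → Congruent d x y
  ≈⇒Congruent d {x} {y} eq = LCS-≈ε (suc d) (trans (∙-congʳ eq) (inverseʳ y))

  Congruent-sym : ∀ d {x y} → Congruent d x y → Congruent d y x
  Congruent-sym d {x} {y} l = resp (solve (x ∷ y ∷ []) ((x₀ ∙ₑ x₁ ⁻¹ₑ) ⁻¹ₑ) (x₁ ∙ₑ x₀ ⁻¹ₑ) P.refl) (inv l)

  Congruent-trans : ∀ d {x y z} → Congruent d x y → Congruent d y z → Congruent d x z
  Congruent-trans d {x} {y} {z} l₁ l₂ =
    resp (solve (x ∷ y ∷ z ∷ []) ((x₀ ∙ₑ x₁ ⁻¹ₑ) ∙ₑ (x₁ ∙ₑ x₂ ⁻¹ₑ)) (x₀ ∙ₑ x₂ ⁻¹ₑ) P.refl) (mul l₁ l₂)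

  -- the congruence is compatible with products, by normality
  Congruent-∙ : ∀ d {x x′ y y′} → Congruent d x x′ → Congruent d y y′ → Congruent d (x ∙ y) (x′ ∙ y′)
  Congruent-∙ d {x} {x′} {y} {y′} lx ly =
    resp (solve (x ∷ x′ ∷ y ∷ y′ ∷ []) (conjₑ x₀ (x₂ ∙ₑ x₃ ⁻¹ₑ) ∙ₑ (x₀ ∙ₑ x₁ ⁻¹ₑ)) ((x₀ ∙ₑ x₂) ∙ₑ (x₁ ∙ₑ x₃) ⁻¹ₑ) P.refl)
         (mul (LCS-conj (suc d) x ly) lx)

-- (4) Commutator calculus modulo an elementary abelian kernel.
-- Throughout, φ : G → F_2^N is a homomorphism whose kernel K is an elementary
-- abelian 2-group; since F_2^N is abelian of exponent 2, K contains every
-- commutator, every square, and is normal.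

module KernelCalculus {c ℓ} {N : ℕ} (G : Group c ℓ) (φ : Group.Carrier G → V N)
    (φ-cong   : ∀ {x y} → Group._≈_ G x y → φ x ≡ φ y)
    (φ-hom    : ∀ x y → φ (Group._∙_ G x y) ≡ φ x ⊕ φ y)
    (ker-comm : ∀ {x y} → φ x ≡ 𝟎 → φ y ≡ 𝟎 → Group._≈_ G (Group._∙_ G x y) (Group._∙_ G y x))
    (ker-sq   : ∀ {x} → φ x ≡ 𝟎 → Group._≈_ G (Group._∙_ G x x) (Group.ε G)) where
  open Group G
  open GroupDefs G
  open LowerCentralSeries G public
  open import Relation.Binary.Reasoning.Setoid setoid hiding (step-≡-⟩; step-≡-∣; step-≡-⟨; step-≡˘)

  InKer : Carrier → Set
  InKer x = φ x ≡ 𝟎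

  φ-ε : φ ε ≡ 𝟎
  φ-ε = P.trans (φ-cong (sym (identityˡ ε))) (P.trans (φ-hom ε ε) (⊕-self (φ ε)))

  φ-inv : ∀ x → φ (x ⁻¹) ≡ φ x
  φ-inv x = P.sym (⊕-cancel (φ x) (φ (x ⁻¹))
    (P.trans (P.sym (φ-hom x (x ⁻¹))) (P.trans (φ-cong (inverseʳ x)) φ-ε)))

  φ-≡⇒InKer : ∀ {x y} → φ x ≡ φ y → InKer (x ∙ y ⁻¹)
  φ-≡⇒InKer {x} {y} eq = P.trans (φ-hom x (y ⁻¹)) (P.trans (P.cong₂ _⊕_ eq (φ-inv y)) (⊕-self (φ y)))

  InKer⇒φ-≡ : ∀ {x y} → InKer (x ∙ y ⁻¹) → φ x ≡ φ y
  InKer⇒φ-≡ {x} {y} k = ⊕-cancel (φ x) (φ y)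
    (P.trans (P.cong (φ x ⊕_) (P.sym (φ-inv y))) (P.trans (P.sym (φ-hom x (y ⁻¹))) k))

  K-∙ : ∀ {a b} → InKer a → InKer b → InKer (a ∙ b)
  K-∙ {a} {b} ka kb = P.trans (φ-hom a b) (P.trans (P.cong₂ _⊕_ ka kb) (⊕-self 𝟎))

  K-inv : ∀ {a} → InKer a → InKer (a ⁻¹)
  K-inv {a} ka = P.trans (φ-inv a) ka

  K-resp : ∀ {a b} → a ≈ b → InKer a → InKer b
  K-resp eq ka = P.trans (P.sym (φ-cong eq)) ka

  K-comm : ∀ x y → InKer (comm x y)
  K-comm x y = begin⟨φ⟩
    φ (comm x y)                                   ≡⟨ φ-hom _ _ ⟩
    φ (x ∙ y ∙ x ⁻¹) ⊕ φ (y ⁻¹)                    ≡⟨ P.cong₂ _⊕_ (φ-hom _ _) (φ-inv y) ⟩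
    (φ (x ∙ y) ⊕ φ (x ⁻¹)) ⊕ φ y                   ≡⟨ P.cong₂ (λ s t → (s ⊕ t) ⊕ φ y) (φ-hom x y) (φ-inv x) ⟩
    ((φ x ⊕ φ y) ⊕ φ x) ⊕ φ y                      ≡⟨ ⊕-commutator (φ x) (φ y) ⟩
    𝟎                                              ∎⟨φ⟩
    where open P.≡-Reasoning renaming (begin_ to begin⟨φ⟩_; _∎ to _∎⟨φ⟩)

  K-conj : ∀ x {w} → InKer w → InKer (conj x w)
  K-conj x {w} kw = K-resp (solve (x ∷ w ∷ []) (⟪ x₀ , x₁ ⟫ ∙ₑ x₁) (conjₑ x₀ x₁) P.refl) (K-∙ (K-comm x w) kw)

  K-sq : ∀ x → InKer (x ∙ x)
  K-sq x = P.trans (φ-hom x x) (⊕-self (φ x))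

  K-inv≈ : ∀ {a} → InKer a → a ⁻¹ ≈ a
  K-inv≈ {a} ka = begin
    a ⁻¹              ≈⟨ sym (identityʳ _) ⟩
    a ⁻¹ ∙ ε          ≈⟨ ∙-congˡ (sym (ker-sq ka)) ⟩
    a ⁻¹ ∙ (a ∙ a)    ≈⟨ solve (a ∷ []) (x₀ ⁻¹ₑ ∙ₑ (x₀ ∙ₑ x₀)) x₀ P.refl ⟩
    a                 ∎

  -- Identities between products of elements of K, decided by computing the
  -- exponent (mod 2) of each atom.

  infixl 7 _⊛_
  data KExpr : Set where
    k[_] : ℕ → KExpr
    _⊛_  : KExpr → KExpr → KExpr
    kinv : KExpr → KExpr
    kε   : KExpr

  keval : List Carrier → KExpr → Carrier
  keval ρ k[ i ] = get ρ i
  keval ρ (a ⊛ b) = keval ρ a ∙ keval ρ b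
  keval ρ (kinv a) = keval ρ a ⁻¹
  keval ρ kε = ε

  -- exponent vectors over F_2, as lists padded implicitly with false
  xorList : List Bool → List Bool → List Bool
  xorList [] w = w
  xorList (a ∷ v) [] = a ∷ v
  xorList (a ∷ v) (b ∷ w) = (a xor b) ∷ xorList v w

  unitList : ℕ → List Bool
  unitList zero = true ∷ []
  unitList (suc i) = false ∷ unitList i

  exponents : KExpr → List Bool
  exponents k[ i ] = unitList i
  exponents (a ⊛ b) = xorList (exponents a) (exponents b)
  exponents (kinv a) = exponents a
  exponents kε = []

  allFalse : List Bool → Bool
  allFalse [] = true
  allFalse (true ∷ _) = false
  allFalse (false ∷ v) = allFalse v

  head : List Carrier → Carrier
  head [] = ε
  head (x ∷ _) = x

  tail : List Carrier → List Carrier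
  tail [] = []
  tail (_ ∷ xs) = xs

  power : Bool → Carrier → Carrier
  power true x = x
  power false x = ε

  monomial : List Carrier → List Bool → Carrier
  monomial ρ [] = ε
  monomial ρ (b ∷ v) = power b (head ρ) ∙ monomial (tail ρ) v

  head-K : ∀ {ρ} → All InKer ρ → InKer (head ρ)
  head-K [] = φ-ε
  head-K (k ∷ _) = k

  tail-K : ∀ {ρ} → All InKer ρ → All InKer (tail ρ)
  tail-K [] = []
  tail-K (_ ∷ ks) = ks

  get-K : ∀ {ρ} → All InKer ρ → ∀ i → InKer (get ρ i)
  get-K [] i = φ-ε
  get-K (k ∷ ks) zero = k
  get-K (k ∷ ks) (suc i) = get-K ks i

  power-K : ∀ b {x} → InKer x → InKer (power b x)
  power-K true k = k
  power-K false k = φ-ε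

  monomial-K : ∀ {ρ} → All InKer ρ → ∀ v → InKer (monomial ρ v)
  monomial-K kρ [] = φ-ε
  monomial-K kρ (b ∷ v) = K-∙ (power-K b (head-K kρ)) (monomial-K (tail-K kρ) v)

  keval-K : ∀ {ρ} → All InKer ρ → ∀ a → InKer (keval ρ a)
  keval-K kρ k[ i ] = get-K kρ i
  keval-K kρ (a ⊛ b) = K-∙ (keval-K kρ a) (keval-K kρ b)
  keval-K kρ (kinv a) = K-inv (keval-K kρ a)
  keval-K kρ kε = φ-ε

  power-xor : ∀ a b {x} → InKer x → power (a xor b) x ≈ power a x ∙ power b x
  power-xor true true k = sym (ker-sq k)
  power-xor true false k = sym (identityʳ _)
  power-xor false true k = sym (identityˡ _)
  power-xor false false k = sym (identityˡ _)

  K-interchange : ∀ {a b c d} → InKer b → InKer c → (a ∙ b) ∙ (c ∙ d) ≈ (a ∙ c) ∙ (b ∙ d)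
  K-interchange {a} {b} {c} {d} kb kc = begin
    (a ∙ b) ∙ (c ∙ d)  ≈⟨ solve (a ∷ b ∷ c ∷ d ∷ []) ((x₀ ∙ₑ x₁) ∙ₑ (x₂ ∙ₑ x₃)) (x₀ ∙ₑ (x₁ ∙ₑ x₂) ∙ₑ x₃) P.refl ⟩
    a ∙ (b ∙ c) ∙ d    ≈⟨ ∙-congʳ (∙-congˡ (ker-comm kb kc)) ⟩
    a ∙ (c ∙ b) ∙ d    ≈⟨ solve (a ∷ b ∷ c ∷ d ∷ []) (x₀ ∙ₑ (x₂ ∙ₑ x₁) ∙ₑ x₃) ((x₀ ∙ₑ x₂) ∙ₑ (x₁ ∙ₑ x₃)) P.refl ⟩
    (a ∙ c) ∙ (b ∙ d)  ∎

  monomial-xor : ∀ {ρ} → All InKer ρ → ∀ v w → monomial ρ (xorList v w) ≈ monomial ρ v ∙ monomial ρ w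
  monomial-xor kρ [] w = sym (identityˡ _)
  monomial-xor kρ (a ∷ v) [] = sym (identityʳ _)
  monomial-xor {ρ} kρ (a ∷ v) (b ∷ w) = begin
    power (a xor b) (head ρ) ∙ monomial (tail ρ) (xorList v w)
      ≈⟨ ∙-cong (power-xor a b (head-K kρ)) (monomial-xor (tail-K kρ) v w) ⟩
    (power a (head ρ) ∙ power b (head ρ)) ∙ (monomial (tail ρ) v ∙ monomial (tail ρ) w)
      ≈⟨ K-interchange (power-K b (head-K kρ)) (monomial-K (tail-K kρ) v) ⟩
    (power a (head ρ) ∙ monomial (tail ρ) v) ∙ (power b (head ρ) ∙ monomial (tail ρ) w)  ∎

  monomial-unit : ∀ ρ i → monomial ρ (unitList i) ≈ get ρ i
  monomial-unit [] zero = identityʳ _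
  monomial-unit (x ∷ ρ) zero = identityʳ _
  monomial-unit [] (suc i) = trans (identityˡ _) (monomial-unit [] i)
  monomial-unit (x ∷ ρ) (suc i) = trans (identityˡ _) (monomial-unit ρ i)

  exponents-sound : ∀ {ρ} → All InKer ρ → ∀ a → keval ρ a ≈ monomial ρ (exponents a)
  exponents-sound {ρ} kρ k[ i ] = sym (monomial-unit ρ i)
  exponents-sound kρ (a ⊛ b) =
    trans (∙-cong (exponents-sound kρ a) (exponents-sound kρ b)) (sym (monomial-xor kρ (exponents a) (exponents b)))
  exponents-sound kρ (kinv a) = trans (K-inv≈ (keval-K kρ a)) (exponents-sound kρ a)
  exponents-sound kρ kε = refl

  allFalse-sound : ∀ ρ v → allFalse v ≡ true → monomial ρ v ≈ ε
  allFalse-sound ρ [] _ = refl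
  allFalse-sound ρ (false ∷ v) eq = trans (identityˡ _) (allFalse-sound (tail ρ) v eq)

  ksolve : ∀ ρ → All InKer ρ → ∀ a b → allFalse (exponents (a ⊛ b)) ≡ true → keval ρ a ≈ keval ρ b
  ksolve ρ kρ a b eq = begin
    keval ρ a                          ≈⟨ sym (identityʳ _) ⟩
    keval ρ a ∙ ε                      ≈⟨ ∙-congˡ (sym (ker-sq (keval-K kρ b))) ⟩
    keval ρ a ∙ (keval ρ b ∙ keval ρ b) ≈⟨ sym (assoc _ _ _) ⟩
    (keval ρ a ∙ keval ρ b) ∙ keval ρ b ≈⟨ ∙-congʳ (trans (exponents-sound kρ (a ⊛ b)) (allFalse-sound ρ (exponents (a ⊛ b)) eq)) ⟩
    ε ∙ keval ρ b                      ≈⟨ identityˡ _ ⟩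
    keval ρ b                          ∎

  comm-K : ∀ {x y} → InKer x → InKer y → comm x y ≈ ε
  comm-K kx ky = comm-commuting (ker-comm kx ky)

  comm-swap : ∀ x y → comm y x ≈ comm x y
  comm-swap x y = trans (sym (comm-inv y x)) (K-inv≈ (K-comm x y))

  -- the conjugation action of G on K factors through G/K, and K acts trivially
  conj-K : ∀ {k z w} → InKer k → InKer w → conj (k ∙ z) w ≈ conj z w
  conj-K {z = z} kk kw = conj-absorb (ker-comm kk (K-conj z kw))

  conj-KK : ∀ {k w} → InKer k → InKer w → conj k w ≈ w
  conj-KK {k} {w} kk kw = begin
    conj k w        ≈⟨ conj-cong (sym (identityʳ k)) refl ⟩
    conj (k ∙ ε) w  ≈⟨ conj-K kk kw ⟩
    conj ε w        ≈⟨ solve (w ∷ []) (conjₑ εₑ x₀) x₀ P.refl ⟩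
    w               ∎

  comm-K-congˡ : ∀ {a b w} → InKer (a ∙ b ⁻¹) → InKer w → comm a w ≈ comm b w
  comm-K-congˡ {b = b} kab kw = comm-absorb (ker-comm kab (K-conj b kw))

  -- Obtained by rewriting ˣ[y,z] as [ˣy , ˣz] = [[x,y] y , [x,z] z]
  -- and collecting the resulting factors inside K.
  ker-expansion : ∀ x y z → comm x (comm y z) ≈
                  (comm x y ∙ conj z (comm x y)) ∙ (comm x z ∙ conj y (comm x z))
  ker-expansion x y z = begin
    comm x (comm y z)                  ≈⟨ comm-via-conj x (comm y z) ⟩
    conj x (comm y z) ∙ C ⁻¹           ≈⟨ ∙-congʳ conj-x-C ⟩
    (a ∙ conj y b ∙ conj z a ∙ C ∙ b ⁻¹) ∙ C ⁻¹
      ≈⟨ ksolve (a ∷ conj y b ∷ conj z a ∷ C ∷ b ∷ [])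
                (K-comm x y ∷ K-conj y (K-comm x z) ∷ K-conj z (K-comm x y) ∷ K-comm y z ∷ K-comm x z ∷ [])
                ((k[ 0 ] ⊛ k[ 1 ] ⊛ k[ 2 ] ⊛ k[ 3 ] ⊛ kinv k[ 4 ]) ⊛ kinv k[ 3 ])
                ((k[ 0 ] ⊛ k[ 2 ]) ⊛ (k[ 4 ] ⊛ k[ 1 ])) P.refl ⟩
    (a ∙ conj z a) ∙ (b ∙ conj y b)    ∎
    where
    a = comm x y
    b = comm x z
    C = comm y z
    conj-via-comm : ∀ u v → conj u v ≈ comm u v ∙ v
    conj-via-comm u v = solve (u ∷ v ∷ []) (conjₑ x₀ x₁) (⟪ x₀ , x₁ ⟫ ∙ₑ x₁) P.refl
    conj-x-C : conj x (comm y z) ≈ a ∙ conj y b ∙ conj z a ∙ C ∙ b ⁻¹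
    conj-x-C = begin
      conj x (comm y z)         ≈⟨ solve (x ∷ y ∷ z ∷ []) (conjₑ x₀ ⟪ x₁ , x₂ ⟫) ⟪ conjₑ x₀ x₁ , conjₑ x₀ x₂ ⟫ P.refl ⟩
      comm (conj x y) (conj x z) ≈⟨ comm-cong (conj-via-comm x y) (conj-via-comm x z) ⟩
      comm (a ∙ y) (b ∙ z)
        ≈⟨ solve (a ∷ y ∷ b ∷ z ∷ []) ⟪ x₀ ∙ₑ x₁ , x₂ ∙ₑ x₃ ⟫
                 (x₀ ∙ₑ conjₑ x₁ x₂ ∙ₑ conjₑ (conjₑ x₁ x₃) (x₀ ⁻¹ₑ) ∙ₑ ⟪ x₁ , x₃ ⟫ ∙ₑ x₂ ⁻¹ₑ) P.refl ⟩
      a ∙ conj y b ∙ conj (conj y z) (a ⁻¹) ∙ C ∙ b ⁻¹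
        ≈⟨ ∙-congʳ (∙-congʳ (∙-congˡ (begin
             conj (conj y z) (a ⁻¹)  ≈⟨ conj-cong (conj-via-comm y z) refl ⟩
             conj (C ∙ z) (a ⁻¹)     ≈⟨ conj-K (K-comm y z) (K-inv (K-comm x y)) ⟩
             conj z (a ⁻¹)           ≈⟨ conj-cong refl (K-inv≈ (K-comm x y)) ⟩
             conj z a                ∎))) ⟩
      a ∙ conj y b ∙ conj z a ∙ C ∙ b ⁻¹  ∎

  jacobi-exact : ∀ x y z → comm x (comm y z) ∙ (comm y (comm z x) ∙ comm z (comm x y)) ≈ ε
  jacobi-exact x y z = begin
    comm x (comm y z) ∙ (comm y (comm z x) ∙ comm z (comm x y))
      ≈⟨ ∙-cong (ker-expansion x y z) (∙-cong (ker-expansion y z x) (ker-expansion z x y)) ⟩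
    ((A ∙ conj z A) ∙ (B ∙ conj y B)) ∙ (((C ∙ conj x C) ∙ (comm y x ∙ conj z (comm y x)))
        ∙ ((comm z x ∙ conj y (comm z x)) ∙ (comm z y ∙ conj x (comm z y))))
      ≈⟨ ∙-congˡ (∙-cong (∙-congˡ (swapped x y z)) (∙-cong (swapped x z y) (swapped y z x))) ⟩
    ((A ∙ conj z A) ∙ (B ∙ conj y B)) ∙ (((C ∙ conj x C) ∙ (A ∙ conj z A))
        ∙ ((B ∙ conj y B) ∙ (C ∙ conj x C)))
      ≈⟨ ksolve (A ∷ conj z A ∷ B ∷ conj y B ∷ C ∷ conj x C ∷ [])
                (K-comm x y ∷ K-conj z (K-comm x y) ∷ K-comm x z ∷ K-conj y (K-comm x z) ∷
                 K-comm y z ∷ K-conj x (K-comm y z) ∷ [])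
                (((k[ 0 ] ⊛ k[ 1 ]) ⊛ (k[ 2 ] ⊛ k[ 3 ])) ⊛
                 (((k[ 4 ] ⊛ k[ 5 ]) ⊛ (k[ 0 ] ⊛ k[ 1 ])) ⊛ ((k[ 2 ] ⊛ k[ 3 ]) ⊛ (k[ 4 ] ⊛ k[ 5 ]))))
                kε P.refl ⟩
    ε ∎
    where
    A = comm x y
    B = comm x z
    C = comm y z
    swapped : ∀ u v w → comm v u ∙ conj w (comm v u) ≈ comm u v ∙ conj w (comm u v)
    swapped u v w = ∙-cong (comm-swap u v) (conj-cong refl (comm-swap u v))

  comm-exchange : ∀ g h {w} → InKer w → comm g (comm h w) ≈ comm h (comm g w)
  comm-exchange g h {w} kw = begin
    comm g (comm h w)                 ≈⟨ ker-expansion g h w ⟩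
    (u ∙ conj w u) ∙ (p ∙ conj h p)   ≈⟨ ∙-congʳ (∙-congˡ (conj-KK kw (K-comm g h))) ⟩
    (u ∙ u) ∙ (p ∙ conj h p)
      ≈⟨ ksolve (u ∷ p ∷ conj h p ∷ []) (K-comm g h ∷ K-comm g w ∷ K-conj h (K-comm g w) ∷ [])
                ((k[ 0 ] ⊛ k[ 0 ]) ⊛ (k[ 1 ] ⊛ k[ 2 ])) (k[ 2 ] ⊛ kinv k[ 1 ]) P.refl ⟩
    conj h p ∙ p ⁻¹                   ≈⟨ sym (comm-via-conj h p) ⟩
    comm h (comm g w)                 ∎
    where
    u = comm g h
    p = comm g w

  -- for u ∈ K, [b,[b,u]] = 1: the square of b acts trivially on K
  comm-twice : ∀ b {u} → InKer u → comm b (comm b u) ≈ ε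
  comm-twice b {u} ku = begin
    comm b (comm b u)                                      ≈⟨ ker-expansion b b u ⟩
    (o ∙ conj u o) ∙ (comm b u ∙ conj b (comm b u))
      ≈⟨ ∙-cong (∙-congˡ (conj-KK ku (K-comm b b))) (∙-cong (comm-via-conj b u) conj-b-comm) ⟩
    (o ∙ o) ∙ ((conj b u ∙ u ⁻¹) ∙ (u ∙ conj b u ⁻¹))
      ≈⟨ ksolve (o ∷ conj b u ∷ u ∷ []) (K-comm b b ∷ K-conj b ku ∷ ku ∷ [])
                ((k[ 0 ] ⊛ k[ 0 ]) ⊛ ((k[ 1 ] ⊛ kinv k[ 2 ]) ⊛ (k[ 2 ] ⊛ kinv k[ 1 ]))) kε P.refl ⟩
    ε                                                      ∎
    where
    o = comm b b
    conj-b-comm : conj b (comm b u) ≈ u ∙ conj b u ⁻¹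
    conj-b-comm = begin
      conj b (comm b u)               ≈⟨ solve (b ∷ u ∷ []) (conjₑ x₀ ⟪ x₀ , x₁ ⟫)
                                               (conjₑ (x₀ ∙ₑ x₀) x₁ ∙ₑ conjₑ x₀ x₁ ⁻¹ₑ) P.refl ⟩
      conj (b ∙ b) u ∙ conj b u ⁻¹    ≈⟨ ∙-congʳ (conj-KK (K-sq b) ku) ⟩
      u ∙ conj b u ⁻¹                 ∎

  open RawGradedLie (LieOf G) using (iter; nested)

  iter-K : ∀ n σ {z} → InKer z → InKer (iter n σ z)
  iter-K zero σ kz = kz
  iter-K (suc n) σ kz = K-comm _ _

  iter-≡ : ∀ n {σ τ : Fin n → Carrier} z → (∀ t → σ t ≡ τ t) → iter n σ z ≡ iter n τ z
  iter-≡ zero z eq = P.refl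
  iter-≡ (suc n) z eq = P.cong₂ comm (eq Fin.zero) (iter-≡ n z (λ t → eq (Fin.suc t)))

  iter-extract : ∀ n (σ : Fin (suc n) → Carrier) (k : Fin (suc n)) {z} → InKer z →
                 iter (suc n) σ z ≈ comm (σ k) (iter n (λ t → σ (punchIn k t)) z)
  iter-extract n σ Fin.zero kz = refl
  iter-extract (suc n) σ (Fin.suc k) {z} kz =
    trans (comm-cong refl (iter-extract n (λ t → σ (Fin.suc t)) k kz))
          (comm-exchange (σ Fin.zero) (σ (Fin.suc k)) (iter-K n _ kz))

  iter-permute : ∀ n (σ : Fin n → Carrier) (p : Permutation′ n) {z} → InKer z →
                 iter n (λ t → σ (p ⟨$⟩ʳ t)) z ≈ iter n σ z
  iter-permute zero σ p kz = refl
  iter-permute (suc n) σ p {z} kz = begin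
    comm (σ k) (iter n (λ t → σ (p ⟨$⟩ʳ Fin.suc t)) z)
      ≈⟨ reflexive (P.cong (comm (σ k)) (iter-≡ n z (λ t → P.cong σ (punchIn-permute p Fin.zero t)))) ⟩
    comm (σ k) (iter n (λ t → σ (punchIn k (remove Fin.zero p ⟨$⟩ʳ t))) z)
      ≈⟨ comm-cong refl (iter-permute n (λ t → σ (punchIn k t)) (remove Fin.zero p) kz) ⟩
    comm (σ k) (iter n (λ t → σ (punchIn k t)) z)   ≈⟨ sym (iter-extract n σ k kz) ⟩
    iter (suc n) σ z                                ∎
    where
    k = p ⟨$⟩ʳ Fin.zero

  iter-repeat : ∀ r (σ : Fin (suc (suc r)) → Carrier) (p q : Fin (suc (suc r))) → ¬ p ≡ q →
                InKer (σ p ∙ σ q ⁻¹) → ∀ {z} → InKer z → iter (suc (suc r)) σ z ≈ ε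
  iter-repeat r σ p q p≢q kpq {z} kz = begin
    iter (suc (suc r)) σ z                                ≈⟨ iter-extract (suc r) σ p kz ⟩
    comm (σ p) (iter (suc r) (λ t → σ (punchIn p t)) z)   ≈⟨ comm-cong refl (iter-extract r (λ t → σ (punchIn p t)) q′ kz) ⟩
    comm (σ p) (comm (σ (punchIn p q′)) U)                ≈⟨ reflexive (P.cong (λ t → comm (σ p) (comm (σ t) U)) (punchIn-punchOut p≢q)) ⟩
    comm (σ p) (comm (σ q) U)                             ≈⟨ comm-K-congˡ kpq (K-comm _ _) ⟩
    comm (σ q) (comm (σ q) U)                             ≈⟨ comm-twice (σ q) (iter-K r _ kz) ⟩
    ε                                                     ∎
    where
    q′ = punchOut p≢q
    U = iter r (λ t → σ (punchIn p (punchIn q′ t))) z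

  nested-K : ∀ m σ → InKer (nested m σ)
  nested-K zero σ = K-comm _ _
  nested-K (suc m) σ = K-comm _ _

-- (5) For an N-expansion group (G, φ, g), L_•(G) with ψ = φ in degree one is
-- an N-expansion Lie algebra.  Here K = ker φ = G^{(2)}.

module ExpansionLie {c ℓ} {N : ℕ} (G : Group c ℓ) (φ : Group.Carrier G → V N)
    (g : Fin N → Group.Carrier G) (H : IsExpansionGroup G N φ g) where
  open Group G
  open GroupDefs G
  open IsExpansionGroup H
  open KernelCalculus G φ φ-cong φ-hom ker-comm ker-sq public
  open RawGradedLie (LieOf G) using (nested; BrSpan; bzero; bbr; bplus; bresp)
  open import Relation.Binary.Reasoning.Setoid setoid

  LCS⊆K : ∀ d {x} → LCS (suc d) x → InKer x
  LCS⊆K zero l = der⊆ker l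
  LCS⊆K (suc d) l = LCS⊆K d (LCS-suc (suc d) l)

  -- [G^{(i+1)} , G^{(j+1)}] ⊆ G^{(i+j+2)}; when i, j ≥ 1 both entries lie in
  -- the abelian group K and the commutator is trivial
  LCS-bracket : ∀ i j {x y} → LCS i x → LCS j y → LCS (suc (i + j)) (comm x y)
  LCS-bracket zero j lx ly = LCS-commʳ j ly
  LCS-bracket (suc i) zero {x} {y} lx ly =
    P.subst (λ t → LCS (suc (suc t)) (comm x y)) (P.sym (+-identityʳ i)) (LCS-commˡ (suc i) lx)
  LCS-bracket (suc i) (suc j) lx ly = LCS-≈ε _ (comm-K (LCS⊆K i lx) (LCS⊆K j ly))

  bracket-congˡ : ∀ i j {x x′ y} → LCS i x′ → LCS j y → Congruent i x x′ →
                  Congruent (suc (i + j)) (comm x y) (comm x′ y)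
  bracket-congˡ i j {x} {x′} {y} lx′ ly d =
    resp (solve (x ∷ x′ ∷ y ∷ [])
                (⟪ x₀ ∙ₑ x₁ ⁻¹ₑ , ⟪ x₁ , x₂ ⟫ ⟫ ∙ₑ conjₑ ⟪ x₁ , x₂ ⟫ ⟪ x₀ ∙ₑ x₁ ⁻¹ₑ , x₂ ⟫)
                (⟪ x₀ , x₂ ⟫ ∙ₑ ⟪ x₁ , x₂ ⟫ ⁻¹ₑ) P.refl)
         (mul (LCS-antitone le (LCS-bracket (suc i) (suc (i + j)) d (LCS-bracket i j lx′ ly)))
              (LCS-conj (suc (suc (i + j))) (comm x′ y) (LCS-bracket (suc i) j d ly)))
    where
    le : suc (suc (i + j)) ≤ suc (suc (i + suc (i + j)))
    le = s≤s (s≤s (≤-trans (n≤1+n (i + j)) (m≤n+m (suc (i + j)) i)))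

  bracket-congʳ : ∀ i j {x y y′} → LCS i x → LCS j y′ → Congruent j y y′ →
                  Congruent (suc (i + j)) (comm x y) (comm x y′)
  bracket-congʳ i j {x} {y} {y′} lx ly′ d =
    resp (solve (x ∷ y ∷ y′ ∷ [])
                (⟪ x₀ , x₁ ∙ₑ x₂ ⁻¹ₑ ⟫ ∙ₑ ⟪ x₁ ∙ₑ x₂ ⁻¹ₑ , ⟪ x₀ , x₂ ⟫ ⟫)
                (⟪ x₀ , x₁ ⟫ ∙ₑ ⟪ x₀ , x₂ ⟫ ⁻¹ₑ) P.refl)
         (mul (P.subst (λ t → LCS (suc t) (comm x (y ∙ y′ ⁻¹))) (+-suc i j) (LCS-bracket i (suc j) lx d))
              (LCS-antitone le (LCS-bracket (suc j) (suc (i + j)) d (LCS-bracket i j lx ly′))))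
    where
    le : suc (suc (i + j)) ≤ suc (suc (j + suc (i + j)))
    le = s≤s (s≤s (≤-trans (n≤1+n (i + j)) (m≤n+m (suc (i + j)) j)))

  bracket-cong : ∀ i j {x x′ y y′} → LCS i x → LCS i x′ → LCS j y′ →
                 Congruent i x x′ → Congruent j y y′ → Congruent (suc (i + j)) (comm x y) (comm x′ y′)
  bracket-cong i j lx lx′ ly′ dx dy =
    Congruent-trans (suc (i + j)) (bracket-congʳ i j lx ly′ dy) (bracket-congˡ i j lx′ ly′ dx)

  bracket-distribˡ : ∀ i j {x y y′} → LCS i x → LCS j y′ →
                     Congruent (suc (i + j)) (comm x (y ∙ y′)) (comm x y ∙ comm x y′)
  bracket-distribˡ i j {x} {y} {y′} lx ly′ =
    resp (solve (x ∷ y ∷ y′ ∷ []) (conjₑ ⟪ x₀ , x₁ ⟫ ⟪ x₁ , ⟪ x₀ , x₂ ⟫ ⟫)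
                                  (⟪ x₀ , x₁ ∙ₑ x₂ ⟫ ∙ₑ (⟪ x₀ , x₁ ⟫ ∙ₑ ⟪ x₀ , x₂ ⟫) ⁻¹ₑ) P.refl)
         (LCS-conj (suc (suc (i + j))) (comm x y) (LCS-commʳ (suc (i + j)) (LCS-bracket i j lx ly′)))

  bracket-distribʳ : ∀ i j {x x′ y} → LCS i x′ → LCS j y →
                     Congruent (suc (i + j)) (comm (x ∙ x′) y) (comm x y ∙ comm x′ y)
  bracket-distribʳ i j {x} {x′} {y} lx′ ly =
    resp (solve (x ∷ x′ ∷ y ∷ []) (⟪ x₀ , ⟪ x₁ , x₂ ⟫ ⟫ ∙ₑ ⟪ ⟪ x₁ , x₂ ⟫ , ⟪ x₀ , x₂ ⟫ ⟫)
                                  (⟪ x₀ ∙ₑ x₁ , x₂ ⟫ ∙ₑ (⟪ x₀ , x₂ ⟫ ∙ₑ ⟪ x₁ , x₂ ⟫) ⁻¹ₑ) P.refl)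
         (mul (LCS-commʳ (suc (i + j)) (LCS-bracket i j lx′ ly))
              (LCS-commˡ (suc (i + j)) (LCS-bracket i j lx′ ly)))

  -- every L_m has exponent 2: in degree 1 because G/K ≅ F_2^N, above because K does
  square-congruent : ∀ d {x} → LCS d x → Congruent d (x ∙ x) ε
  square-congruent zero {x} _ = ker⊆der (φ-≡⇒InKer (P.trans (K-sq x) (P.sym φ-ε)))
  square-congruent (suc d) {x} l = ≈⇒Congruent (suc d) (ker-sq (LCS⊆K d l))

  isGradedLieAlgebra : IsGradedLieAlgebra (LieOf G)
  isGradedLieAlgebra = record
    { ≈-refl   = λ {d} _ → ≈⇒Congruent d refl
    ; ≈-sym    = λ {d} _ _ → Congruent-sym d
    ; ≈-trans  = λ {d} _ _ _ → Congruent-trans d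
    ; 0-mem    = λ {d} → LCS-ε d
    ; +-mem    = λ {d} → LCS-∙ d
    ; +-cong   = λ {d} _ _ _ _ → Congruent-∙ d
    ; +-assoc  = λ {d} _ _ _ → ≈⇒Congruent d (assoc _ _ _)
    ; +-comm   = λ {d} {x} {y} _ ly →
        resp (solve (x ∷ y ∷ []) ⟪ x₀ , x₁ ⟫ ((x₀ ∙ₑ x₁) ∙ₑ (x₁ ∙ₑ x₀) ⁻¹ₑ) P.refl) (LCS-commʳ d ly)
    ; +-idˡ    = λ {d} _ → ≈⇒Congruent d (identityˡ _)
    ; +-self   = λ {d} → square-congruent d
    ; br-mem   = λ {i} {j} → LCS-bracket i j
    ; br-cong  = λ {i} {j} lx lx′ _ ly′ → bracket-cong i j lx lx′ ly′
    ; br-distˡ = λ {i} {j} lx _ ly′ → bracket-distribˡ i j lx ly′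
    ; br-distʳ = λ {i} {j} _ lx′ ly → bracket-distribʳ i j lx′ ly
    ; br-alt   = λ {x = x} _ → ≈⇒Congruent _ (solve (x ∷ []) ⟪ x₀ , x₀ ⟫ εₑ P.refl)
    ; br-anti  = λ {x = x} {y = y} _ _ → ≈⇒Congruent _ (comm-swap y x)
    ; jacobi   = λ {x = x} {y = y} {z = z} _ _ _ → ≈⇒Congruent _ (jacobi-exact x y z)
    }

  LCS-spanned : ∀ d {x} → LCS (suc d) x → BrSpan (suc d) x
  LCS-spanned d (gen {z} (x , y , ly , eq)) =
    bresp {x = comm x y} (gen (x , y , ly , eq)) (≈⇒Congruent (suc d) (sym eq)) (bbr {i = 0} {j = d} tt ly P.refl)
  LCS-spanned d unit = bzero
  LCS-spanned d (mul a b) = bplus (LCS-spanned d a) (LCS-spanned d b)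
  LCS-spanned d (inv a) = bresp (inv a) (≈⇒Congruent (suc d) (sym (K-inv≈ (LCS⊆K d a)))) (LCS-spanned d a)
  LCS-spanned d (resp eq a) = bresp (resp eq a) (≈⇒Congruent (suc d) eq) (LCS-spanned d a)

  ker-part-K : ∀ i {x} → KerPart (LieOf G) φ i x → InKer x
  ker-part-K zero (_ , k) = k
  ker-part-K (suc i) l = LCS⊆K i l

  φ-onto : ∀ v → Σ Carrier (λ x → ⊤ {c ⊔ ℓ} × φ x ≡ v)
  φ-onto = basis-induction N (λ v → Σ Carrier (λ x → ⊤ {c ⊔ ℓ} × φ x ≡ v))
    (λ { (x , _ , px) (y , _ , py) → x ∙ y , tt , P.trans (φ-hom x y) (P.cong₂ _⊕_ px py) })
    (ε , tt , φ-ε) (λ i → g i , tt , φ-gen i)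

  congruent-generator : ∀ {σ a} → φ σ ≡ e a → Congruent 0 σ (g a)
  congruent-generator {σ} {a} eq = ker⊆der (φ-≡⇒InKer (P.trans eq (P.sym (φ-gen a))))

  nested-LCS : ∀ m σ → LCS (suc m) (nested m σ)
  nested-LCS zero σ = LCS-commʳ 0 tt
  nested-LCS (suc m) σ = LCS-commʳ (suc m) (nested-LCS m (λ t → σ (Fin.suc t)))

  nested-cong : ∀ m (σ τ : Fin (suc (suc m)) → Carrier) → (∀ t → Congruent 0 (σ t) (τ t)) →
                Congruent (suc m) (nested m σ) (nested m τ)
  nested-cong zero σ τ d = bracket-cong 0 0 tt tt tt (d Fin.zero) (d (Fin.suc Fin.zero))
  nested-cong (suc m) σ τ d =
    bracket-cong 0 (suc m) tt tt (nested-LCS m (λ t → τ (Fin.suc t))) (d Fin.zero)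
                 (nested-cong m (λ t → σ (Fin.suc t)) (λ t → τ (Fin.suc t)) (λ t → d (Fin.suc t)))

  g-inv : ∀ a → g a ⁻¹ ≈ g a
  g-inv a = begin
    g a ⁻¹                  ≈⟨ sym (identityʳ _) ⟩
    g a ⁻¹ ∙ ε              ≈⟨ ∙-congˡ (sym (g-sq a)) ⟩
    g a ⁻¹ ∙ (g a ∙ g a)    ≈⟨ solve (g a ∷ []) (x₀ ⁻¹ₑ ∙ₑ (x₀ ∙ₑ x₀)) x₀ P.refl ⟩
    g a                     ∎

  -- [g_a , [g_a , w]] = 1 for every w, since g_a is an involution
  generator-twice : ∀ a w → comm (g a) (comm (g a) w) ≈ ε
  generator-twice a w = begin
    comm u (comm u w)                 ≈⟨ comm-via-conj u (comm u w) ⟩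
    conj u (comm u w) ∙ comm u w ⁻¹   ≈⟨ ∙-cong conj-u-comm (comm-inv w u) ⟩
    comm w u ∙ comm w u               ≈⟨ ker-sq (K-comm w u) ⟩
    ε                                 ∎
    where
    u = g a
    conj-u-comm : conj u (comm u w) ≈ comm w u
    conj-u-comm = begin
      conj u (comm u w)
        ≈⟨ solve (u ∷ w ∷ []) (conjₑ x₀ ⟪ x₀ , x₁ ⟫) ((x₀ ∙ₑ x₀) ∙ₑ x₁ ∙ₑ x₀ ⁻¹ₑ ∙ₑ x₁ ⁻¹ₑ ∙ₑ x₀ ⁻¹ₑ) P.refl ⟩
      (u ∙ u) ∙ w ∙ u ⁻¹ ∙ w ⁻¹ ∙ u ⁻¹  ≈⟨ ∙-congʳ (∙-congʳ (∙-cong (∙-congʳ (g-sq a)) (g-inv a))) ⟩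
      ε ∙ w ∙ u ∙ w ⁻¹ ∙ u ⁻¹           ≈⟨ solve (u ∷ w ∷ []) (εₑ ∙ₑ x₁ ∙ₑ x₀ ∙ₑ x₁ ⁻¹ₑ ∙ₑ x₀ ⁻¹ₑ) ⟪ x₁ , x₀ ⟫ P.refl ⟩
      comm w u                          ∎

  isExpansionLieAlgebra : IsExpansionLieAlgebra N (LieOf G) φ
  isExpansionLieAlgebra = record
    { isGradedLieAlgebra = isGradedLieAlgebra
    ; ψ-cong      = λ _ _ l → InKer⇒φ-≡ (der⊆ker l)
    ; ψ-+         = λ {x} {y} _ _ → φ-hom x y
    ; ψ-surj      = φ-onto
    ; ker-abelian = λ {i} {j} kx ky → ≈⇒Congruent _ (comm-K (ker-part-K i kx) (ker-part-K j ky))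
    ; ker⊆der₁    = λ { (_ , k) → ker⊆der (K-∙ k (K-inv φ-ε)) }
    ; ker⊆der     = λ {d} → LCS-spanned d
    ; nest-perm   = λ r σ {x} {y} _ _ _ p → ≈⇒Congruent _ (iter-permute (suc (suc r)) σ p (K-comm x y))
    ; nest-rep    = λ r σ {x} {y} _ _ _ p q p≢q d →
        ≈⇒Congruent _ (iter-repeat r σ p q p≢q (der⊆ker d) (K-comm x y))
    ; basis-sq    = λ { {τ₁} {τ₂} _ _ (i , eq) →
        Congruent-trans 2
          (bracket-cong 0 1 tt tt (LCS-commʳ 0 tt) (congruent-generator eq)
                        (bracket-cong 0 0 tt tt tt (congruent-generator eq) (≈⇒Congruent 0 refl)))
          (≈⇒Congruent 2 (generator-twice i τ₂)) }
    }

-- (6) The block conditions for a [(k_1,…,k_n)]-expansion group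

module KExpansionLie {c ℓ} {n : ℕ} (ks : Vec ℕ n) (G : Group c ℓ) (φ : Group.Carrier G → V (sum ks))
    (g : Fin (sum ks) → Group.Carrier G) (H : IsKExpansionGroup ks G φ g) where
  open Group G
  open GroupDefs G
  open IsKExpansionGroup H
  open IsExpansionGroup isExpansionGroup using (φ-hom; φ-gen)
  open ExpansionLie G φ g isExpansionGroup
  open RawGradedLie (LieOf G) using (nested)
  open import Relation.Binary.Reasoning.Setoid setoid

  InPreπ : Carrier → Set
  InPreπ x = π ks (φ x) ≡ 𝟎

  K⊆Preπ : ∀ {x} → InKer x → InPreπ x
  K⊆Preπ kx = P.trans (P.cong (π ks) kx) (π-𝟎 ks)

  preπ-part : ∀ i {x} → PreπPart ks (LieOf G) φ i x → InPreπ x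
  preπ-part zero (_ , p) = p
  preπ-part (suc i) l = K⊆Preπ (LCS⊆K i l)

  same-block-Preπ : ∀ {a b} → SameBlock ks a b → InPreπ (g a ∙ g b ⁻¹)
  same-block-Preπ {a} {b} same =
    P.trans (P.cong (π ks) (P.trans (φ-hom _ _) (P.cong₂ _⊕_ (φ-gen a) (P.trans (φ-inv (g b)) (φ-gen b)))))
            (π-same-block ks same)

  -- generators from one block commute: [g_a , g_b] = (g_a g_b⁻¹)² = 1
  same-block-commute : ∀ {a b} → SameBlock ks a b → comm (g a) (g b) ≈ ε
  same-block-commute {a} {b} same = begin
    g a ∙ g b ∙ g a ⁻¹ ∙ g b ⁻¹   ≈⟨ ∙-congʳ (∙-cong (∙-congˡ (sym (g-inv b))) (g-inv a)) ⟩
    g a ∙ g b ⁻¹ ∙ g a ∙ g b ⁻¹   ≈⟨ solve (g a ∷ g b ∷ []) (x₀ ∙ₑ x₁ ⁻¹ₑ ∙ₑ x₀ ∙ₑ x₁ ⁻¹ₑ)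
                                           ((x₀ ∙ₑ x₁ ⁻¹ₑ) ∙ₑ (x₀ ∙ₑ x₁ ⁻¹ₑ)) P.refl ⟩
    (g a ∙ g b ⁻¹) ∙ (g a ∙ g b ⁻¹) ≈⟨ preπ-sq (same-block-Preπ same) ⟩
    ε                             ∎

  same-block-comm : ∀ {a b w} → SameBlock ks a b → InKer w → comm (g a) w ≈ comm (g b) w
  same-block-comm {b = b} same kw = comm-absorb (preπ-comm (same-block-Preπ same) (K⊆Preπ (K-conj (g b) kw)))

  comm-nested-same-block : ∀ m a (idx : Fin (suc (suc m)) → Fin (sum ks)) q → SameBlock ks a (idx q) →
                           comm (g a) (nested m (λ t → g (idx t))) ≈ ε
  comm-nested-same-block zero a idx Fin.zero same =
    trans (same-block-comm same (K-comm _ _)) (generator-twice _ _)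
  comm-nested-same-block zero a idx (Fin.suc Fin.zero) same =
    trans (same-block-comm same (K-comm _ _)) (trans (comm-cong refl (comm-swap _ _)) (generator-twice _ _))
  comm-nested-same-block (suc m) a idx Fin.zero same =
    trans (same-block-comm same (K-comm _ _)) (generator-twice _ _)
  comm-nested-same-block (suc m) a idx (Fin.suc q) same =
    trans (comm-exchange (g a) (g (idx Fin.zero)) (nested-K m _))
          (trans (comm-cong refl (comm-nested-same-block m a (λ t → idx (Fin.suc t)) q same)) (comm-ε _))

  nested-same-block : ∀ m (idx : Fin (suc (suc m)) → Fin (sum ks)) (p q : Fin (suc (suc m))) → ¬ p ≡ q →
                      SameBlock ks (idx p) (idx q) → nested m (λ t → g (idx t)) ≈ ε
  nested-same-block m idx Fin.zero Fin.zero p≢q _ = ⊥-elim (p≢q P.refl)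
  nested-same-block zero idx Fin.zero (Fin.suc Fin.zero) _ same = same-block-commute same
  nested-same-block zero idx (Fin.suc Fin.zero) Fin.zero _ same = same-block-commute (P.sym same)
  nested-same-block zero idx (Fin.suc Fin.zero) (Fin.suc Fin.zero) p≢q _ = ⊥-elim (p≢q P.refl)
  nested-same-block (suc m) idx Fin.zero (Fin.suc q) _ same =
    comm-nested-same-block m (idx Fin.zero) (λ t → idx (Fin.suc t)) q same
  nested-same-block (suc m) idx (Fin.suc p) Fin.zero _ same =
    comm-nested-same-block m (idx Fin.zero) (λ t → idx (Fin.suc t)) p (P.sym same)
  nested-same-block (suc m) idx (Fin.suc p) (Fin.suc q) p≢q same =
    trans (comm-cong refl (nested-same-block m (λ t → idx (Fin.suc t)) p q (λ eq → p≢q (P.cong Fin.suc eq)) same))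
          (comm-ε _)

  isKExpansionLieAlgebra : IsKExpansionLieAlgebra ks (LieOf G) φ
  isKExpansionLieAlgebra = record
    { isExpansionLieAlgebra = isExpansionLieAlgebra
    ; preπ-abelian = λ {i} {j} px py →
        ≈⇒Congruent _ (comm-commuting (preπ-comm (preπ-part i px) (preπ-part j py)))
    ; block-rep = λ m idx σ p q p≢q same _ ψσ≡e →
        Congruent-trans (suc m) (nested-cong m σ (λ t → g (idx t)) (λ t → congruent-generator (ψσ≡e t)))
                                (≈⇒Congruent (suc m) (nested-same-block m idx p q p≢q same))
    }

-- Proposition 3.18

proposition3p18 : ∀ {c ℓ} {n : ℕ} (ks : Vec ℕ n) → (∀ s → 1 ≤ lookup ks s) →
    (G : Group c ℓ) (φ : Group.Carrier G → V (sum ks)) (g : Fin (sum ks) → Group.Carrier G) →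
    IsKExpansionGroup ks G φ g →
    IsKExpansionLieAlgebra ks (LieOf G) φ
proposition3p18 ks _ G φ g H = KExpansionLie.isKExpansionLieAlgebra ks G φ g H
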